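{- Let $F(X,Y)$ be a propositional formula over disjoint variable sets $X$ and $Y$, and let $P(X,Y,S)$ and $N(X,Y,T)$ be CNF formulas, with $S$, $T$, $X\cup Y$ pairwise disjoint, such that $\exists S\,[P(X,Y,S)]\equiv \neg\exists T\,[N(X,Y,T)]$. Let $I$ be a total assignment to $X\cup Y\cup S$ that satisfies $P$. Let $D$ be a clause consisting only of complements of literals of $I|_{X\cup Y}$ such that $N\models D$ (e.g. the clause obtained by conflict analysis after the conflict in $N$ under the assumptions $I|_{X\cup Y}$), and let $I^*=(\neg D)|_X$, where $\neg D$ is the cube of the complements of the literals of $D$. Then $I^*$ is a (partial) model of $\exists Y,S\,[P(X,Y,S)]$, i.e. every total assignment to $X$ extending $I^*$ satisfies $\exists Y,S\,[P(X,Y,S)]$.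
   Context: For an assignment or cube $J$ and a set of variables $Z$, $J|_Z$ denotes the restriction of $J$ to the literals whose variables lie in $Z$. A partial assignment $J$ is a (partial) model of a formula $G$, written $J\models G$, if every total assignment extending $J$ satisfies $G$. -}

module Defs where

open import Data.Nat using (ℕ; _≟_)
open import Data.Bool using (Bool; not)
open import Data.Product using (_×_; _,_; proj₁; proj₂; Σ)
open import Data.Sum using (_⊎_)
open import Data.Empty using (⊥)
open import Data.List using (List; map; filter; _++_)
open import Data.List.Membership.Propositional using (_∈_)
open import Data.List.Membership.DecPropositional _≟_ using (_∈?_)
open import Relation.Nullary using (¬_)
open import Relation.Binary.PropositionalEquality using (_≡_)
open import Function.Bundles using (_⇔_)

Var : Set
Var = ℕ

VarSet : Set
VarSet = List Var

-- A literal is a variable with a polarity (true = positive, false = negated).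
Literal : Set
Literal = Var × Bool

var : Literal → Var
var = proj₁

compl : Literal → Literal
compl (v , b) = (v , not b)

Clause : Set
Clause = List Literal

Cube : Set
Cube = List Literal

CNF : Set
CNF = List Clause

-- Total assignments (to all variables; values outside the relevant sets are irrelevant).
Assignment : Set
Assignment = Var → Bool

_⊨lit_ : Assignment → Literal → Set
α ⊨lit (v , b) = α v ≡ b

_⊨clause_ : Assignment → Clause → Set
α ⊨clause C = Σ Literal λ l → l ∈ C × α ⊨lit l

_⊨cnf_ : Assignment → CNF → Set
α ⊨cnf F = ∀ C → C ∈ F → α ⊨clause C

Extends : Assignment → Cube → Set
Extends α J = ∀ l → l ∈ J → α ⊨lit l

VarsIn : CNF → VarSet → Set
VarsIn F Z = ∀ C → C ∈ F → ∀ l → l ∈ C → var l ∈ Z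

Disjoint : VarSet → VarSet → Set
Disjoint A B = ∀ v → v ∈ A → v ∈ B → ⊥

AgreeOn : VarSet → Assignment → Assignment → Set
AgreeOn Z α β = ∀ v → v ∈ Z → α v ≡ β v

-- ∃ W [F], evaluated at a total assignment α: F is satisfied by some
-- assignment differing from α only on variables in W.
ExistsSat : VarSet → CNF → Assignment → Set
ExistsSat W F α = Σ Assignment λ β → (∀ v → ¬ (v ∈ W) → β v ≡ α v) × β ⊨cnf F

restrict : Cube → VarSet → Cube
restrict J Z = filter (λ l → var l ∈? Z) J

negClause : Clause → Cube
negClause D = map compl D

_⊨ᶜ_ : CNF → Clause → Set
F ⊨ᶜ D = ∀ α → α ⊨cnf F → α ⊨clause D

ComplOfRestr : Clause → Assignment → VarSet → Set
ComplOfRestr D I Z = ∀ l → l ∈ D → var l ∈ Z × I ⊨lit compl l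

{-# OPTIONS --safe #-}
-- Let δ agree with α on X and with I elsewhere.  Every literal of D is false
-- under δ: on X because α extends (¬D)|_X, on Y because I falsifies D.  As the
-- variables of D avoid T, any witness of ∃T[N] at δ would falsify D as well,
-- contradicting N ⊨ D; hence ∃S[P] holds at δ.  Since P only mentions X ∪ Y ∪ S
-- and δ agrees with α on X, the same witness, patched with α outside
-- X ∪ Y ∪ S, shows ∃Y,S[P] at α.
module Submission where

open import Defs
open import Data.Bool.Properties using (not-¬)
open import Data.Empty using (⊥-elim)
open import Data.List using (_++_)
open import Data.List.Membership.Propositional using (_∈_)
open import Data.List.Membership.Propositional.Properties using (∈-++⁺ˡ; ∈-++⁻; ∈-map⁺; ∈-filter⁺)
open import Data.Nat using (_≟_)
open import Data.List.Membership.DecPropositional _≟_ using (_∈?_)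
open import Data.Product using (_,_; proj₁; proj₂)
open import Data.Sum using (inj₁; inj₂)
open import Function.Bundles using (_⇔_; Equivalence)
open import Relation.Nullary using (¬_; yes; no)
open import Relation.Binary.PropositionalEquality using (_≡_; refl; sym; trans)

⊨lit-compl⇒¬⊨lit : ∀ α l → α ⊨lit compl l → ¬ (α ⊨lit l)
⊨lit-compl⇒¬⊨lit α (v , b) αv≡¬b αv≡b = not-¬ αv≡b αv≡¬b

⊨lit-cong : ∀ α β l → α (var l) ≡ β (var l) → α ⊨lit l → β ⊨lit l
⊨lit-cong α β l αv≡βv αl = trans (sym αv≡βv) αl

⊨cnf-local : ∀ {α β} F Z → VarsIn F Z → AgreeOn Z α β → α ⊨cnf F → β ⊨cnf F
⊨cnf-local {α} {β} F Z varsF α≈β αF C C∈F with αF C C∈F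
... | l , l∈C , αl = l , l∈C , ⊨lit-cong α β l (α≈β (var l) (varsF C C∈F l l∈C)) αl

override : VarSet → Assignment → Assignment → Assignment
override Z α γ v with v ∈? Z
... | yes _ = α v
... | no  _ = γ v

override-inside : ∀ Z α γ {v} → v ∈ Z → override Z α γ v ≡ α v
override-inside Z α γ {v} v∈Z with v ∈? Z
... | yes _   = refl
... | no  v∉Z = ⊥-elim (v∉Z v∈Z)

override-outside : ∀ Z α γ {v} → ¬ (v ∈ Z) → override Z α γ v ≡ γ v
override-outside Z α γ {v} v∉Z with v ∈? Z
... | yes v∈Z = ⊥-elim (v∉Z v∈Z)
... | no  _   = refl

override-agreeOn : ∀ Z α γ → AgreeOn Z (override Z α γ) α
override-agreeOn Z α γ v = override-inside Z α γ

¬ExistsSat-of-⊨ᶜ : ∀ W F D α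
  → F ⊨ᶜ D → (∀ l → l ∈ D → ¬ (var l ∈ W)) → (∀ l → l ∈ D → α ⊨lit compl l)
  → ¬ ExistsSat W F α
¬ExistsSat-of-⊨ᶜ W F D α F⊨D D∩W≡∅ α¬D (β , β≈α , βF) with F⊨D β βF
... | l , l∈D , βl =
  ⊨lit-compl⇒¬⊨lit β l (⊨lit-cong α β (compl l) (sym (β≈α (var l) (D∩W≡∅ l l∈D))) (α¬D l l∈D)) βl

ExistsSat-transfer : ∀ X W S F {δ α}
  → VarsIn F (X ++ W) → Disjoint S X → AgreeOn X δ α
  → ExistsSat S F δ → ExistsSat W F α
ExistsSat-transfer X W S F {δ} {α} varsF S∩X≡∅ δ≈α (β , β≈δ , βF) =
  override (X ++ W) β α , outsideW , ⊨cnf-local F (X ++ W) varsF β≈β′ βF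
  where
  β≈β′ : AgreeOn (X ++ W) β (override (X ++ W) β α)
  β≈β′ v v∈XW = sym (override-inside (X ++ W) β α v∈XW)

  outsideW : ∀ v → ¬ (v ∈ W) → override (X ++ W) β α v ≡ α v
  outsideW v v∉W with v ∈? X
  ... | yes v∈X = trans (override-inside (X ++ W) β α (∈-++⁺ˡ v∈X))
                        (trans (β≈δ v (λ v∈S → S∩X≡∅ v v∈S v∈X)) (δ≈α v v∈X))
  ... | no  v∉X = override-outside (X ++ W) β α v∉XW
    where
    v∉XW : ¬ (v ∈ X ++ W)
    v∉XW v∈XW with ∈-++⁻ X v∈XW
    ... | inj₁ v∈X = v∉X v∈X
    ... | inj₂ v∈W = v∉W v∈W

override-falsifies : ∀ X Y D I α
  → ComplOfRestr D I (X ++ Y) → Extends α (restrict (negClause D) X)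
  → ∀ l → l ∈ D → override X α I ⊨lit compl l
override-falsifies X Y D I α D⊆¬I α⊨¬D|X l l∈D with var l ∈? X
... | yes v∈X = α⊨¬D|X (compl l) (∈-filter⁺ (λ l → var l ∈? X) (∈-map⁺ compl l∈D) v∈X)
... | no  _   = proj₂ (D⊆¬I l l∈D)

proposition5 : (X Y S T : VarSet) (P N : CNF)
    → Disjoint X Y → Disjoint S T → Disjoint S (X ++ Y) → Disjoint T (X ++ Y)
    → VarsIn P (X ++ Y ++ S) → VarsIn N (X ++ Y ++ T)
    → (∀ α → ExistsSat S P α ⇔ (¬ ExistsSat T N α))
    → (I : Assignment) → I ⊨cnf P
    → (D : Clause) → ComplOfRestr D I (X ++ Y) → N ⊨ᶜ D
    → ∀ α → Extends α (restrict (negClause D) X)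
    → ExistsSat (Y ++ S) P α
proposition5 X Y S T P N _ _ S∩XY≡∅ T∩XY≡∅ varsP _ ∃P⇔¬∃N I _ D D⊆¬I N⊨D α α⊨¬D|X =
  ExistsSat-transfer X (Y ++ S) S P varsP S∩X≡∅ (override-agreeOn X α I) ∃P-at-δ
  where
  δ : Assignment
  δ = override X α I

  ¬∃N-at-δ : ¬ ExistsSat T N δ
  ¬∃N-at-δ = ¬ExistsSat-of-⊨ᶜ T N D δ N⊨D
    (λ l l∈D v∈T → T∩XY≡∅ (var l) v∈T (proj₁ (D⊆¬I l l∈D)))
    (override-falsifies X Y D I α D⊆¬I α⊨¬D|X)

  ∃P-at-δ : ExistsSat S P δ
  ∃P-at-δ = Equivalence.from (∃P⇔¬∃N δ) ¬∃N-at-δ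

  S∩X≡∅ : Disjoint S X
  S∩X≡∅ v v∈S v∈X = S∩XY≡∅ v v∈S (∈-++⁺ˡ v∈X)
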